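{- Let $G$ be a graph on $7$ vertices such that $G$ is not $3$-colorable, $G$ has no induced $K_4$, and $G$ has no vertex of degree $\ge5$. Then $G$ is a core.
   Context: Graphs are finite, simple, undirected, loopless. $G$ is a core if every homomorphism (edge-preserving map) $G\to G$ is bijective. -}

module Defs where

open import Data.Nat using (ℕ; _≤_)
open import Data.Fin using (Fin)
open import Data.Bool using (Bool; true; false)
open import Data.List using (List; length; filter; allFin)
open import Data.Product using (Σ; ∃; _×_)
open import Relation.Binary.PropositionalEquality using (_≡_; _≢_)
open import Relation.Nullary using (¬_)
open import Data.Bool.Properties using (T?)
open import Data.Bool using (T)

open import Function.Definitions using (Bijective)

record Graph (n : ℕ) : Set where
  field
    adj   : Fin n → Fin n → Bool
    sym   : ∀ u v → adj u v ≡ adj v u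
    irrefl : ∀ v → adj v v ≡ false
open Graph public

Adj : ∀ {n} → Graph n → Fin n → Fin n → Set
Adj G u v = adj G u v ≡ true

degree : ∀ {n} → Graph n → Fin n → ℕ
degree {n} G v = length (filter (λ u → T? (adj G v u)) (allFin n))

IsHom : ∀ {n m} → Graph n → Graph m → (Fin n → Fin m) → Set
IsHom G H f = ∀ u v → Adj G u v → Adj H (f u) (f v)

-- proper k-colouring = homomorphism into K_k, written out
Colourable : ∀ {n} → ℕ → Graph n → Set
Colourable {n} k G = Σ (Fin n → Fin k) λ c → ∀ u v → Adj G u v → c u ≢ c v

-- G contains K_4 as an induced subgraph: four pairwise distinct, pairwise
-- adjacent vertices (any K_4 subgraph is automatically induced).
HasInducedK4 : ∀ {n} → Graph n → Set
HasInducedK4 {n} G = Σ (Fin n) λ a → Σ (Fin n) λ b → Σ (Fin n) λ c → Σ (Fin n) λ d →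
  (a ≢ b) × (a ≢ c) × (a ≢ d) × (b ≢ c) × (b ≢ d) × (c ≢ d) ×
  Adj G a b × Adj G a c × Adj G a d × Adj G b c × Adj G b d × Adj G c d

IsCore : ∀ {n} → Graph n → Set
IsCore {n} G = ∀ (f : Fin n → Fin n) → IsHom G G f → Bijective _≡_ _≡_ f

-- If an endomorphism f of G is not surjective, it maps G into G − w for some
-- vertex w outside its image, and G − w has six vertices. Every graph on six
-- vertices is 3-colourable, contains K₄, or has a vertex adjacent to the five
-- others; this is checked by a search over partially known graphs whose
-- soundness is proved once and whose success is established by evaluation.
-- Each outcome contradicts a hypothesis on G: a 3-colouring of G − w pulls
-- back along f, a K₄ of G − w is a K₄ of G, and a vertex adjacent to five
-- others has degree at least 5 in G. So f is surjective, hence bijective.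
module Submission where

open import Defs
open import Data.Nat using (_<_)
open import Relation.Nullary using (¬_)

open import Data.Bool using (Bool; true; false; _∧_; _∨_; not; T)
open import Data.Bool.Properties using (T?; T-≡; ∧-conicalˡ; ∧-conicalʳ)
import Data.Bool.Properties as Bool
open import Data.Fin using (Fin; zero; suc; punchIn; punchOut)
open import Data.Fin.Properties
  using (_≟_; any?; all?; ¬∀⟶∃¬; injective⇒≤; punchIn-injective; punchInᵢ≢i; punchOut-injective; punchIn-punchOut)
open import Data.List using (List; []; _∷_; [_]; length; filter; allFin; tabulate; map; concatMap)
open import Data.List.Properties using (filter-all; length-tabulate)
open import Data.List.Relation.Binary.Sublist.Propositional using (_⊆_; _∷_; _∷ʳ_; ⊆-refl; ⊆-trans)
open import Data.List.Relation.Binary.Sublist.Propositional.Properties using (filter⁺; length-mono-≤)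
open import Data.List.Relation.Unary.All using (All)
import Data.List.Relation.Unary.All as All
open import Data.List.Relation.Unary.All.Properties using (tabulate⁺)
open import Data.Nat using (ℕ; zero; suc; _≤_)
import Data.Nat.Properties as ℕₚ
open import Data.Product using (∃; ∃₂; _×_; _,_; proj₁; proj₂)
import Data.Product as Product
open import Data.Sum using (_⊎_; inj₁; inj₂)
import Data.Sum as Sum
open import Data.Vec using (Vec; lookup)
import Data.Vec as Vec
open import Data.Vec.Properties using (lookup∘tabulate)
import Data.Vec.Functional as Vector
open import Function using (id; _∘_; _⇔_; mk⇔; Equivalence)
open import Function.Consequences.Propositional using (strictlySurjective⇒surjective)
open import Function.Definitions using (Injective; StrictlySurjective)
open import Relation.Nullary using (Dec; yes; no; does; ¬?; contradiction)
open import Relation.Nullary.Decidable using (_×-dec_; _⊎-dec_; _→-dec_; map′; dec-true; dec-false; does-⇔)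
open import Relation.Binary.PropositionalEquality as ≡ using (_≡_; _≢_; refl; trans; cong; cong₂; subst; subst₂)

private
  variable
    m n k : ℕ
    G H L U : Graph n

adj⇒≢ : (G : Graph n) {u v : Fin n} → Adj G u v → u ≢ v
adj⇒≢ G {u} uv refl = contradiction (trans (≡.sym uv) (irrefl G u)) λ ()

Adj? : (G : Graph n) (u v : Fin n) → Dec (Adj G u v)
Adj? G u v = adj G u v Bool.≟ true

from-does : {A : Set} (a? : Dec A) → does a? ≡ true → A
from-does (yes a) _ = a

_⊆ᴱ_ : Graph n → Graph n → Set
G ⊆ᴱ H = IsHom G H id

IsUniversal : Graph n → Fin n → Set
IsUniversal G v = ∀ u → u ≢ v → Adj G v u

deleteVertex : Graph (suc n) → Fin (suc n) → Graph n
deleteVertex G w = record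
  { adj    = λ u v → adj G (punchIn w u) (punchIn w v)
  ; sym    = λ u v → sym G (punchIn w u) (punchIn w v)
  ; irrefl = λ v → irrefl G (punchIn w v)
  }

emptyGraph : Graph n
emptyGraph = record { adj = λ _ _ → false ; sym = λ _ _ → refl ; irrefl = λ _ → refl }

completeGraph : Graph n
completeGraph = record
  { adj    = λ u v → not (does (u ≟ v))
  ; sym    = λ u v → cong not (does-⇔ (mk⇔ ≡.sym ≡.sym) (u ≟ v) (v ≟ u))
  ; irrefl = λ v → cong not (dec-true (v ≟ v) refl)
  }

SameEdge : (i j u v : Fin n) → Set
SameEdge i j u v = (u ≡ i × v ≡ j) ⊎ (u ≡ j × v ≡ i)

sameEdge? : (i j u v : Fin n) → Dec (SameEdge i j u v)
sameEdge? i j u v = (u ≟ i ×-dec v ≟ j) ⊎-dec (u ≟ j ×-dec v ≟ i)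

SameEdge-swap : {i j u v : Fin n} → SameEdge i j u v → SameEdge i j v u
SameEdge-swap = Sum.swap ∘ Sum.map Product.swap Product.swap

SameEdge-sym : {i j u v : Fin n} → SameEdge i j u v ⇔ SameEdge i j v u
SameEdge-sym = mk⇔ SameEdge-swap SameEdge-swap

addEdge : (G : Graph n) (i j : Fin n) → i ≢ j → Graph n
addEdge G i j i≢j = record
  { adj    = λ u v → adj G u v ∨ does (sameEdge? i j u v)
  ; sym    = λ u v → cong₂ _∨_ (sym G u v) (does-⇔ SameEdge-sym (sameEdge? i j u v) (sameEdge? i j v u))
  ; irrefl = λ v → cong₂ _∨_ (irrefl G v) (dec-false (sameEdge? i j v v) λ where
      (inj₁ (refl , refl)) → i≢j refl
      (inj₂ (refl , refl)) → i≢j refl)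
  }

removeEdge : (G : Graph n) (i j : Fin n) → Graph n
removeEdge G i j = record
  { adj    = λ u v → adj G u v ∧ not (does (sameEdge? i j u v))
  ; sym    = λ u v → cong₂ _∧_ (sym G u v)
                       (cong not (does-⇔ SameEdge-sym (sameEdge? i j u v) (sameEdge? i j v u)))
  ; irrefl = λ v → cong (_∧ _) (irrefl G v)
  }

lookup-tabulate² : (f : Fin n → Fin n → Bool) (u v : Fin n) →
                   lookup (lookup (Vec.tabulate λ u → Vec.tabulate (f u)) u) v ≡ f u v
lookup-tabulate² f u v =
  trans (cong (λ row → lookup row v) (lookup∘tabulate _ u)) (lookup∘tabulate (f u) v)

-- Storing the adjacency in a table keeps the long chains of edits built by
-- the search cheap to evaluate.
tabulateGraph : Graph n → Graph n
tabulateGraph {n} G = fromTable (Vec.tabulate λ u → Vec.tabulate (adj G u)) (lookup-tabulate² (adj G))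
  where
  fromTable : (t : Vec (Vec Bool n) n) → (∀ u v → lookup (lookup t u) v ≡ adj G u v) → Graph n
  fromTable t t≡G = record
    { adj    = λ u v → lookup (lookup t u) v
    ; sym    = λ u v → trans (t≡G u v) (trans (sym G u v) (≡.sym (t≡G v u)))
    ; irrefl = λ v → trans (t≡G v v) (irrefl G v)
    }

Colourable-pullback : {f : Fin m → Fin n} {H : Graph n} → IsHom G H f → Colourable k H → Colourable k G
Colourable-pullback {f = f} f-hom (c , proper) = c ∘ f , λ u v uv → proper (f u) (f v) (f-hom u v uv)

HasInducedK4-pushforward : {f : Fin m → Fin n} {H : Graph n} →
                           IsHom G H f → Injective _≡_ _≡_ f → HasInducedK4 G → HasInducedK4 H
HasInducedK4-pushforward {f = f} f-hom f-inj
  (a , b , c , d , a≢b , a≢c , a≢d , b≢c , b≢d , c≢d , ab , ac , ad , bc , bd , cd) =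
  f a , f b , f c , f d ,
  a≢b ∘ f-inj , a≢c ∘ f-inj , a≢d ∘ f-inj , b≢c ∘ f-inj , b≢d ∘ f-inj , c≢d ∘ f-inj ,
  f-hom a b ab , f-hom a c ac , f-hom a d ad , f-hom b c bc , f-hom b d bd , f-hom c d cd

IsUniversal-⊆ᴱ : L ⊆ᴱ H → ∀ {v} → IsUniversal L v → IsUniversal H v
IsUniversal-⊆ᴱ L⊆H {v} universal u u≢v = L⊆H v u (universal u u≢v)

punchIn-isHom : (G : Graph (suc n)) (w : Fin (suc n)) → IsHom (deleteVertex G w) G (punchIn w)
punchIn-isHom G w u v uv = uv

punchOut-isHom : {f : Fin m → Fin (suc n)} {H : Graph (suc n)} {w : Fin (suc n)} →
                 (f-hom : IsHom G H f) (w∉f : ∀ x → f x ≢ w) →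
                 IsHom G (deleteVertex H w) (λ x → punchOut (w∉f x ∘ ≡.sym))
punchOut-isHom {H = H} f-hom w∉f u v uv =
  subst₂ (Adj H) (≡.sym (punchIn-punchOut _)) (≡.sym (punchIn-punchOut _)) (f-hom u v uv)

emptyGraph-⊆ᴱ : (G : Graph n) → emptyGraph ⊆ᴱ G
emptyGraph-⊆ᴱ G u v ()

⊆ᴱ-completeGraph : (G : Graph n) → G ⊆ᴱ completeGraph
⊆ᴱ-completeGraph G u v uv = cong not (dec-false (u ≟ v) (adj⇒≢ G uv))

tabulateGraph-⊆ᴱ : (G : Graph n) → tabulateGraph G ⊆ᴱ G
tabulateGraph-⊆ᴱ G u v uv = trans (≡.sym (lookup-tabulate² (adj G) u v)) uv

⊆ᴱ-tabulateGraph : (G : Graph n) → G ⊆ᴱ tabulateGraph G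
⊆ᴱ-tabulateGraph G u v uv = trans (lookup-tabulate² (adj G) u v) uv

addEdge-⊆ᴱ : {i j : Fin n} {i≢j : i ≢ j} → L ⊆ᴱ H → Adj H i j → addEdge L i j i≢j ⊆ᴱ H
addEdge-⊆ᴱ {L = L} {H = H} {i = i} {j} L⊆H ij u v uv with adj L u v in uv∈L
... | true  = L⊆H u v uv∈L
... | false with from-does (sameEdge? i j u v) uv
...   | inj₁ (refl , refl) = ij
...   | inj₂ (refl , refl) = trans (sym H j i) ij

⊆ᴱ-removeEdge : {i j : Fin n} → H ⊆ᴱ U → adj H i j ≡ false → H ⊆ᴱ removeEdge U i j
⊆ᴱ-removeEdge {H = H} {i = i} {j} H⊆U ij∉H u v uv =
  cong₂ _∧_ (H⊆U u v uv) (cong not (dec-false (sameEdge? i j u v) uv≢ij))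
  where
  uv≢ij : ¬ SameEdge i j u v
  uv≢ij (inj₁ (refl , refl)) = contradiction (trans (≡.sym uv) ij∉H) λ ()
  uv≢ij (inj₂ (refl , refl)) = contradiction (trans (≡.sym uv) (trans (sym H j i) ij∉H)) λ ()

tabulate-punchIn-⊆ : {A : Set} (h : Fin (suc n) → A) (w : Fin (suc n)) →
                     tabulate (h ∘ punchIn w) ⊆ tabulate h
tabulate-punchIn-⊆ h zero = h zero ∷ʳ ⊆-refl
tabulate-punchIn-⊆ {n = suc n} h (suc w) = refl ∷ tabulate-punchIn-⊆ (h ∘ suc) w

neighbours-≤-degree : (G : Graph n) (x : Fin n) {xs : List (Fin n)} →
                      xs ⊆ allFin n → All (Adj G x) xs → length xs ≤ degree G x
neighbours-≤-degree {n} G x xs⊆V xs⊆N =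
  subst (_≤ degree G x) (cong length (filter-all P? (All.map (Equivalence.from T-≡) xs⊆N)))
        (length-mono-≤ (filter⁺ P? P? (λ { refl p → p }) xs⊆V))
  where
  P? : (u : Fin n) → Dec (T (adj G x u))
  P? u = T? (adj G x u)

deleteVertex-universal⇒≤degree : (G : Graph (suc (suc n))) (w : Fin (suc (suc n))) (v : Fin (suc n)) →
                                 IsUniversal (deleteVertex G w) v → n ≤ degree G (punchIn w v)
deleteVertex-universal⇒≤degree G w v universal =
  subst (_≤ degree G (punchIn w v)) (length-tabulate (punchIn w ∘ punchIn v))
        (neighbours-≤-degree G (punchIn w v)
          (⊆-trans (tabulate-punchIn-⊆ (punchIn w) v) (tabulate-punchIn-⊆ id w))
          (tabulate⁺ λ u → universal (punchIn v u) (punchInᵢ≢i v u)))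

universal? : (G : Graph n) → Dec (∃ (IsUniversal G))
universal? G = any? λ v → all? λ u → ¬? (u ≟ v) →-dec Adj? G v u

-- Adjacency is tested before the next vertex is chosen, so that the search
-- over quadruples is pruned early; distinctness then comes for free.
hasInducedK4? : (G : Graph n) → Dec (HasInducedK4 G)
hasInducedK4? G = map′ fromClique toClique
  (any? λ a → any? λ b → Adj? G a b ×-dec
   any? λ c → (Adj? G a c ×-dec Adj? G b c) ×-dec
   any? λ d → Adj? G a d ×-dec Adj? G b d ×-dec Adj? G c d)
  where
  Clique : Set
  Clique = ∃ λ a → ∃ λ b → Adj G a b ×
           ∃ λ c → (Adj G a c × Adj G b c) ×
           ∃ λ d → Adj G a d × Adj G b d × Adj G c d
  fromClique : Clique → HasInducedK4 G
  fromClique (a , b , ab , c , (ac , bc) , d , ad , bd , cd) =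
    a , b , c , d , adj⇒≢ G ab , adj⇒≢ G ac , adj⇒≢ G ad , adj⇒≢ G bc , adj⇒≢ G bd , adj⇒≢ G cd ,
    ab , ac , ad , bc , bd , cd
  toClique : HasInducedK4 G → Clique
  toClique (a , b , c , d , _ , _ , _ , _ , _ , _ , ab , ac , ad , bc , bd , cd) =
    a , b , ab , c , (ac , bc) , d , ad , bd , cd

monochromaticEdge? : (G : Graph n) (c : Fin n → Fin k) → Dec (∃₂ λ u v → c u ≡ c v × Adj G u v)
monochromaticEdge? G c = any? λ u → any? λ v → c u ≟ c v ×-dec Adj? G u v

colourings : ∀ n k → List (Fin n → Fin k)
colourings zero    k = [ (λ ()) ]
colourings (suc n) k = concatMap (λ x → map (x Vector.∷_) (colourings n k)) (allFin k)

-- The unknown graph lies between L and U, and cs are the colourings not yet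
-- refuted by an edge of L. Once
-- every colouring is refuted, L has to contain K₄ or a universal vertex.
search : ℕ → (L U : Graph n) → List (Fin n → Fin k) → Bool
branch : ℕ → (L U : Graph n) (c : Fin n → Fin k) → List (Fin n → Fin k) →
         Dec (∃₂ λ u v → c u ≡ c v × Adj U u v) → Bool

search fuel L U []       = does (hasInducedK4? L ⊎-dec universal? L)
search fuel L U (c ∷ cs) = branch fuel L U c cs (monochromaticEdge? U c)

branch fuel       L U c cs (no _) = true
branch zero       L U c cs (yes _) = false
branch (suc fuel) L U c cs (yes (i , j , _ , ij∈U)) =
  search fuel (tabulateGraph (addEdge L i j (adj⇒≢ U ij∈U))) U (filter (λ c′ → ¬? (c′ i ≟ c′ j)) cs)
  ∧ search fuel L (tabulateGraph (removeEdge U i j)) (c ∷ cs)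

module _ (H : Graph n) where

  search-sound : (fuel : ℕ) (L U : Graph n) (cs : List (Fin n → Fin k)) →
                 L ⊆ᴱ H → H ⊆ᴱ U → search fuel L U cs ≡ true →
                 Colourable k H ⊎ HasInducedK4 H ⊎ ∃ (IsUniversal H)
  branch-sound : (fuel : ℕ) (L U : Graph n) (c : Fin n → Fin k) (cs : List (Fin n → Fin k))
                 (mono? : Dec (∃₂ λ u v → c u ≡ c v × Adj U u v)) →
                 L ⊆ᴱ H → H ⊆ᴱ U → branch fuel L U c cs mono? ≡ true →
                 Colourable k H ⊎ HasInducedK4 H ⊎ ∃ (IsUniversal H)

  search-sound fuel L U [] L⊆H H⊆U ok =
    inj₂ (Sum.map (HasInducedK4-pushforward {G = L} {H = H} L⊆H id)
                  (Product.map₂ (IsUniversal-⊆ᴱ {L = L} {H = H} L⊆H))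
                  (from-does (hasInducedK4? L ⊎-dec universal? L) ok))
  search-sound fuel L U (c ∷ cs) = branch-sound fuel L U c cs (monochromaticEdge? U c)

  branch-sound fuel L U c cs (no monochromatic) L⊆H H⊆U ok =
    inj₁ (c , λ u v uv cu≡cv → monochromatic (u , v , cu≡cv , H⊆U u v uv))
  branch-sound (suc fuel) L U c cs (yes (i , j , _ , ij∈U)) L⊆H H⊆U ok with adj H i j in ij∈H
  ... | true  =
    search-sound fuel L′ U (filter (λ c′ → ¬? (c′ i ≟ c′ j)) cs) L′⊆H H⊆U (∧-conicalˡ _ _ ok)
    where
    L⁺ L′ : Graph n
    L⁺ = addEdge L i j (adj⇒≢ U ij∈U)
    L′ = tabulateGraph L⁺
    L′⊆H : L′ ⊆ᴱ H
    L′⊆H u v uv =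
      addEdge-⊆ᴱ {L = L} {H = H} {i≢j = adj⇒≢ U ij∈U} L⊆H ij∈H u v (tabulateGraph-⊆ᴱ L⁺ u v uv)
  ... | false =
    search-sound fuel L U′ (c ∷ cs) L⊆H H⊆U′ (∧-conicalʳ _ _ ok)
    where
    U⁻ U′ : Graph n
    U⁻ = removeEdge U i j
    U′ = tabulateGraph U⁻
    H⊆U′ : H ⊆ᴱ U′
    H⊆U′ u v uv = ⊆ᴱ-tabulateGraph U⁻ u v (⊆ᴱ-removeEdge {H = H} {U = U} H⊆U ij∈H u v uv)

-- Fuel 15 suffices: every split settles one of the 15 pairs of vertices.
sixVertex-trichotomy : (H : Graph 6) → Colourable 3 H ⊎ HasInducedK4 H ⊎ ∃ (IsUniversal H)
sixVertex-trichotomy H =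
  search-sound H 15 emptyGraph completeGraph (colourings 6 3) (emptyGraph-⊆ᴱ H) (⊆ᴱ-completeGraph H) refl

injective⇒strictlySurjective : {f : Fin n → Fin n} → Injective _≡_ _≡_ f → StrictlySurjective _≡_ f
injective⇒strictlySurjective {suc n} {f} f-inj y with any? (λ x → f x ≟ y)
... | yes hit = hit
... | no ¬hit = contradiction (injective⇒≤ g-inj) (ℕₚ.<-irrefl refl)
  where
  y≢f : ∀ x → y ≢ f x
  y≢f x y≡fx = ¬hit (x , ≡.sym y≡fx)
  g : Fin (suc n) → Fin n
  g x = punchOut (y≢f x)
  g-inj : Injective _≡_ _≡_ g
  g-inj gx≡gx′ = f-inj (punchOut-injective (y≢f _) (y≢f _) gx≡gx′)

section-injective : {f : Fin m → Fin n} (onto : StrictlySurjective _≡_ f) → Injective _≡_ _≡_ (proj₁ ∘ onto)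
section-injective {f = f} onto {a} {b} sa≡sb =
  trans (≡.sym (proj₂ (onto a))) (trans (cong f sa≡sb) (proj₂ (onto b)))

strictlySurjective⇒injective : {f : Fin n → Fin n} → StrictlySurjective _≡_ f → Injective _≡_ _≡_ f
strictlySurjective⇒injective onto {x} {y} fx≡fy
  with injective⇒strictlySurjective (section-injective onto) x
     | injective⇒strictlySurjective (section-injective onto) y
... | x′ , refl | y′ , refl =
  cong (proj₁ ∘ onto) (trans (≡.sym (proj₂ (onto x′))) (trans fx≡fy (proj₂ (onto y′))))

strictlySurjective⊎missesVertex : (f : Fin n → Fin n) →
                                  StrictlySurjective _≡_ f ⊎ ∃ λ w → ∀ x → f x ≢ w
strictlySurjective⊎missesVertex f with all? (λ y → any? λ x → f x ≟ y)
... | yes onto  = inj₁ onto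
... | no ¬onto  = inj₂ (Product.map₂ (λ ¬hit x fx≡w → ¬hit (x , fx≡w))
                                   (¬∀⟶∃¬ _ _ (λ y → any? λ x → f x ≟ y) ¬onto))

lemmaA1 : (G : Graph 7) → ¬ Colourable 3 G → ¬ HasInducedK4 G →
    (∀ v → degree G v < 5) → IsCore G
lemmaA1 G not3Colourable noK4 degree<5 f f-hom with strictlySurjective⊎missesVertex f
... | inj₁ onto = strictlySurjective⇒injective onto , strictlySurjective⇒surjective onto
... | inj₂ (w , w∉f) with sixVertex-trichotomy (deleteVertex G w)
...   | inj₁ colourable = contradiction
  (Colourable-pullback {G = G} {H = deleteVertex G w} (punchOut-isHom {G = G} {H = G} f-hom w∉f) colourable)
  not3Colourable
...   | inj₂ (inj₁ k4) = contradiction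
  (HasInducedK4-pushforward {G = deleteVertex G w} {H = G} (punchIn-isHom G w) (punchIn-injective w _ _) k4)
  noK4
...   | inj₂ (inj₂ (v , universal)) = contradiction
  (degree<5 (punchIn w v))
  (ℕₚ.≤⇒≯ (deleteVertex-universal⇒≤degree G w v universal))
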